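{- Let $\lambda$ be a partition with bead-set $X$ normalized with respect to $s$, and suppose the largest element of $X$ lies in row $q-1$ of the $s$-abacus (so the abacus has $s$ runners and rows $0,\dots,q-1$). Then the $s$-abacus of $\lambda$ exhibits horizontal anti-symmetry if and only if $q$ is even, each $s$-quotient component $\lambda_{(i)}$ ($0\le i\le s-1$) is self-conjugate, and each runner contains exactly $q/2$ beads.
   Context: For a partition $\lambda$ with first-column hook lengths $h_1>h_2>\dots$ and an integer $m\ge0$, $X=\{0,1,\dots,m-1\}\cup\{h_\gamma+m\}$ is a bead-set of $\lambda$; it is normalized with respect to $s$ if $m$ is minimal such that $|X|\equiv 0\pmod s$. The $s$-abacus of $X$ places each integer $x\ge0$ at runner $x\bmod s$ and row $\lfloor x/s\rfloor$, with a bead if $x\in X$ and a spacer otherwise. The $s$-quotient component $\lambda_{(i)}$ is the partition determined by $X_i=\{j\ge0:i+js\in X\}$, where a bead-set $Y$ determines the partition with parts the nonzero numbers $|\{z\notin Y:0\le z<y\}|$, $y\in Y$. The abacus exhibits horizontal anti-symmetry if for all runners $i$ and rows $0\le j\le q-1$ there is a bead at $(i,j)$ iff there is a spacer at $(i,q-1-j)$. A partition $\mu$ is self-conjugate if $\mu=\mu^*$ (its conjugate). -}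

module Defs where

open import Data.Nat using (ℕ; zero; suc; _+_; _*_; _∸_; _<_; _≤_; _≥_; _⊔_; _≟_; _≤?_; _<?_)
open import Data.List using (List; []; _∷_; length; map; filter; upTo; reverse; foldr; _++_)
open import Data.List.Relation.Unary.All using (All)
open import Data.List.Relation.Unary.Linked using (Linked)
open import Data.List.Membership.DecPropositional _≟_ using (_∈?_)
open import Relation.Nullary using (¬_)
open import Relation.Nullary.Decidable using (¬?)

IsPartition : List ℕ → Set
IsPartition λ′ = All (0 <_) λ′ × Linked _≥_ λ′
  where open import Data.Product using (_×_)

-- first-column hook lengths h_γ = λ_γ + (ℓ - γ), γ = 1..ℓ
hooks : List ℕ → List ℕ
hooks []       = []
hooks (p ∷ ps) = (p + length ps) ∷ hooks ps

beadSet : ℕ → List ℕ → List ℕ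
beadSet m λ′ = upTo m ++ map (_+ m) (hooks λ′)

maxL : List ℕ → ℕ
maxL = foldr _⊔_ 0

-- X_i = { j ≥ 0 : i + j s ∈ X }, listed in increasing order
-- (every such j satisfies j ≤ i + j s ≤ max X, so j < 1 + max X suffices)
runnerSet : ℕ → ℕ → List ℕ → List ℕ
runnerSet s i X = filter (λ j → (i + j * s) ∈? X) (upTo (suc (maxL X)))

gapsBelow : List ℕ → ℕ → ℕ
gapsBelow Y y = length (filter (λ z → ¬? (z ∈? Y)) (upTo y))

-- the partition determined by a bead-set Y (given in increasing order):
-- parts are the nonzero numbers gapsBelow Y y, y ∈ Y, listed decreasingly
partitionOf : List ℕ → List ℕ
partitionOf Y = reverse (filter (λ n → 0 <? n) (map (gapsBelow Y) Y))

quotientComponent : ℕ → ℕ → List ℕ → List ℕ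
quotientComponent s i X = partitionOf (runnerSet s i X)

conjugate : List ℕ → List ℕ
conjugate μ = map (λ k → length (filter (λ p → suc k ≤? p) μ)) (upTo (maxL μ))

SelfConjugate : List ℕ → Set
SelfConjugate μ = μ ≡ conjugate μ
  where open import Relation.Binary.PropositionalEquality using (_≡_)

-- Read each runner of the abacus as a word in beads and spacers.  The quotient
-- component on a runner is the partition whose parts are the numbers of spacers
-- preceding each bead, and conjugating that partition corresponds to the dual
-- word: reverse the runner and swap beads with spacers.  Horizontal
-- anti-symmetry says precisely that every runner word is self-dual.  A word is
-- self-dual exactly when its partition is self-conjugate and it has as many
-- beads as spacers, because a word is recovered from its partition, its length
-- and its number of beads.  Equally many beads and spacers on a runner of
-- length q means q even with q/2 beads.
module Submission where

open import Defs
open import Data.Bool using (Bool; true; false; not)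
open import Data.Empty using (⊥-elim)
open import Data.List
  using (List; []; _∷_; _++_; [_]; _∷ʳ_; length; map; filter; reverse; upTo; applyUpTo; applyDownFrom)
open import Data.List.Properties
open import Data.List.Relation.Unary.All as All using (All)
open import Data.List.Relation.Unary.All.Properties using (map⁺)
open import Data.List.Relation.Unary.Any using (Any; here; there)
open import Data.List.Membership.Propositional using (_∈_; _∉_; find)
open import Data.List.Membership.Propositional.Properties using (∈-filter⁺; ∈-filter⁻; ∈-upTo⁺; ∈-upTo⁻)
open import Data.Nat
  using (ℕ; zero; suc; _+_; _*_; _∸_; _<_; _≤_; _≤′_; ≤′-refl; ≤′-step; _⊔_; _<?_; _≤?_; z≤n; s≤s; s≤s⁻¹; NonZero; >-nonZero⁻¹; _≟_)
open import Data.Nat.Properties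
open import Data.List.Membership.DecPropositional _≟_ using (_∈?_)
open import Data.Nat.DivMod using (_/_; _%_; m*n/n≡m; m/n*n≡m; /-congˡ; /-monoˡ-≤; m/n≤m)
open import Data.Nat.Divisibility using (_∣_; divides)
open import Data.Product using (_×_; _,_; proj₁; proj₂)
open import Function.Base using (_∘_)
open import Function.Bundles using (_⇔_; mk⇔; Equivalence)
open import Function.Construct.Composition using (_⇔-∘_)
open import Level using (0ℓ)
open import Relation.Binary.PropositionalEquality hiding ([_])
open import Relation.Nullary using (¬_; Dec; yes; no; does; ¬?)
open import Relation.Unary using (Pred; Decidable)

open Equivalence using (to; from)
open ≡-Reasoning

private
  variable
    A : Set

filter-filter-⊆ : ∀ {P Q : Pred A 0ℓ} (P? : Decidable P) (Q? : Decidable Q) → (∀ {x} → P x → Q x) →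
                  ∀ xs → filter P? (filter Q? xs) ≡ filter P? xs
filter-filter-⊆ P? Q? P⇒Q []       = refl
filter-filter-⊆ P? Q? P⇒Q (x ∷ xs) with Q? x
... | no ¬q = trans (filter-filter-⊆ P? Q? P⇒Q xs) (sym (filter-reject P? (¬q ∘ P⇒Q)))
... | yes _ with P? x
...   | yes _ = cong (x ∷_) (filter-filter-⊆ P? Q? P⇒Q xs)
...   | no  _ = filter-filter-⊆ P? Q? P⇒Q xs

filter-reverse : ∀ {P : Pred A 0ℓ} (P? : Decidable P) xs → filter P? (reverse xs) ≡ reverse (filter P? xs)
filter-reverse P? []       = refl
filter-reverse {P = P} P? (x ∷ xs) = begin
  filter P? (reverse (x ∷ xs))              ≡⟨ cong (filter P?) (unfold-reverse x xs) ⟩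
  filter P? (reverse xs ∷ʳ x)               ≡⟨ filter-++ P? (reverse xs) [ x ] ⟩
  filter P? (reverse xs) ++ filter P? [ x ] ≡⟨ cong (_++ filter P? [ x ]) (filter-reverse P? xs) ⟩
  reverse (filter P? xs) ++ filter P? [ x ] ≡⟨ last (P? x) ⟩
  reverse (filter P? (x ∷ xs))              ∎
  where
  last : Dec (P x) → reverse (filter P? xs) ++ filter P? [ x ] ≡ reverse (filter P? (x ∷ xs))
  last (yes p) = begin
    reverse (filter P? xs) ++ filter P? [ x ] ≡⟨ cong (reverse (filter P? xs) ++_) (filter-accept P? p) ⟩
    reverse (filter P? xs) ∷ʳ x               ≡⟨ sym (unfold-reverse x (filter P? xs)) ⟩
    reverse (x ∷ filter P? xs)                ≡⟨ cong reverse (sym (filter-accept P? p)) ⟩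
    reverse (filter P? (x ∷ xs))              ∎
  last (no ¬p) = begin
    reverse (filter P? xs) ++ filter P? [ x ] ≡⟨ cong (reverse (filter P? xs) ++_) (filter-reject P? ¬p) ⟩
    reverse (filter P? xs) ++ []              ≡⟨ ++-identityʳ (reverse (filter P? xs)) ⟩
    reverse (filter P? xs)                    ≡⟨ cong reverse (sym (filter-reject P? ¬p)) ⟩
    reverse (filter P? (x ∷ xs))              ∎

filter-upTo-suc : ∀ {P : Pred ℕ 0ℓ} (P? : Decidable P) n →
                  filter P? (upTo (suc n)) ≡ filter P? (upTo n) ++ filter P? [ n ]
filter-upTo-suc P? n = trans (cong (filter P?) (sym (upTo-∷ʳ n))) (filter-++ P? (upTo n) [ n ])

applyUpTo-cong : ∀ {f g : ℕ → A} n → (∀ j → j < n → f j ≡ g j) → applyUpTo f n ≡ applyUpTo g n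
applyUpTo-cong zero    f≗g = refl
applyUpTo-cong (suc n) f≗g = cong₂ _∷_ (f≗g 0 (s≤s z≤n)) (applyUpTo-cong n (λ j j<n → f≗g (suc j) (s≤s j<n)))

applyUpTo-cong⁻ : ∀ {f g : ℕ → A} n → applyUpTo f n ≡ applyUpTo g n → ∀ j → j < n → f j ≡ g j
applyUpTo-cong⁻ (suc n) e zero    _   = ∷-injectiveˡ e
applyUpTo-cong⁻ (suc n) e (suc j) j<n = applyUpTo-cong⁻ n (∷-injectiveʳ e) j (s≤s⁻¹ j<n)

applyDownFrom≡applyUpTo : ∀ (f : ℕ → A) n → applyDownFrom f n ≡ applyUpTo (λ j → f (n ∸ suc j)) n
applyDownFrom≡applyUpTo f zero    = refl
applyDownFrom≡applyUpTo f (suc n) = cong (f n ∷_) (applyDownFrom≡applyUpTo f n)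

∈⇒≤maxL : ∀ {x} X → x ∈ X → x ≤ maxL X
∈⇒≤maxL (y ∷ X) (here refl) = m≤m⊔n y (maxL X)
∈⇒≤maxL (y ∷ X) (there x∈X) = ≤-trans (∈⇒≤maxL X x∈X) (m≤n⊔m y (maxL X))

does≡not-does⇔ : ∀ {P Q : Set} (P? : Dec P) (Q? : Dec Q) → (does P? ≡ not (does Q?)) ⇔ (P ⇔ (¬ Q))
does≡not-does⇔ (yes p) (yes q) = mk⇔ (λ ()) (λ p⇔¬q → ⊥-elim (to p⇔¬q p q))
does≡not-does⇔ (yes p) (no ¬q) = mk⇔ (λ _ → mk⇔ (λ _ → ¬q) (λ _ → p)) (λ _ → refl)
does≡not-does⇔ (no ¬p) (yes q) = mk⇔ (λ _ → mk⇔ (λ p → ⊥-elim (¬p p)) (λ ¬q → ⊥-elim (¬q q))) (λ _ → refl)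
does≡not-does⇔ (no ¬p) (no ¬q) = mk⇔ (λ ()) (λ p⇔¬q → ⊥-elim (¬p (from p⇔¬q ¬q)))

n*2≡n+m⇔n≡m : ∀ n m → (n * 2 ≡ n + m) ⇔ (n ≡ m)
n*2≡n+m⇔n≡m n m = mk⇔ (λ e → +-cancelˡ-≡ n n m (trans (sym n*2≡n+n) e)) (λ { refl → n*2≡n+n })
  where
  n*2≡n+n : n * 2 ≡ n + n
  n*2≡n+n = trans (*-comm n 2) (cong (n +_) (+-identityʳ n))

-- Words in beads (true) and spacers (false)

beads spacers : List Bool → ℕ
beads []          = 0
beads (true ∷ w)  = suc (beads w)
beads (false ∷ w) = beads w
spacers []          = 0
spacers (true ∷ w)  = spacers w
spacers (false ∷ w) = suc (spacers w)

dual : List Bool → List Bool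
dual w = reverse (map not w)

-- The numbers of spacers preceding the beads of w, from the last bead to the first.
beadGaps : List Bool → List ℕ
beadGaps []          = []
beadGaps (true ∷ w)  = beadGaps w ∷ʳ 0
beadGaps (false ∷ w) = map suc (beadGaps w)

positives : List ℕ → List ℕ
positives = filter (0 <?_)

wordPartition : List Bool → List ℕ
wordPartition w = positives (beadGaps w)

beads-++ : ∀ u v → beads (u ++ v) ≡ beads u + beads v
beads-++ []          v = refl
beads-++ (true ∷ u)  v = cong suc (beads-++ u v)
beads-++ (false ∷ u) v = beads-++ u v

spacers-++ : ∀ u v → spacers (u ++ v) ≡ spacers u + spacers v
spacers-++ []          v = refl
spacers-++ (true ∷ u)  v = spacers-++ u v
spacers-++ (false ∷ u) v = cong suc (spacers-++ u v)

beads+spacers≡length : ∀ w → beads w + spacers w ≡ length w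
beads+spacers≡length []          = refl
beads+spacers≡length (true ∷ w)  = cong suc (beads+spacers≡length w)
beads+spacers≡length (false ∷ w) = trans (+-suc (beads w) (spacers w)) (cong suc (beads+spacers≡length w))

dual-∷ : ∀ b w → dual (b ∷ w) ≡ dual w ∷ʳ not b
dual-∷ b w = unfold-reverse (not b) (map not w)

beads-dual : ∀ w → beads (dual w) ≡ spacers w
beads-dual []      = refl
beads-dual (b ∷ w) = begin
  beads (dual (b ∷ w))            ≡⟨ cong beads (dual-∷ b w) ⟩
  beads (dual w ∷ʳ not b)         ≡⟨ beads-++ (dual w) [ not b ] ⟩
  beads (dual w) + beads [ not b ] ≡⟨ cong (_+ beads [ not b ]) (beads-dual w) ⟩
  spacers w + beads [ not b ]     ≡⟨ last b ⟩
  spacers (b ∷ w)                 ∎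
  where
  last : ∀ b → spacers w + beads [ not b ] ≡ spacers (b ∷ w)
  last true  = +-identityʳ (spacers w)
  last false = +-comm (spacers w) 1

spacers-dual : ∀ w → spacers (dual w) ≡ beads w
spacers-dual []      = refl
spacers-dual (b ∷ w) = begin
  spacers (dual (b ∷ w))              ≡⟨ cong spacers (dual-∷ b w) ⟩
  spacers (dual w ∷ʳ not b)           ≡⟨ spacers-++ (dual w) [ not b ] ⟩
  spacers (dual w) + spacers [ not b ] ≡⟨ cong (_+ spacers [ not b ]) (spacers-dual w) ⟩
  beads w + spacers [ not b ]         ≡⟨ last b ⟩
  beads (b ∷ w)                       ∎
  where
  last : ∀ b → beads w + spacers [ not b ] ≡ beads (b ∷ w)
  last true  = +-comm (beads w) 1
  last false = +-identityʳ (beads w)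

length-dual : ∀ w → length (dual w) ≡ length w
length-dual w = trans (length-reverse (map not w)) (length-map not w)

length-beadGaps : ∀ w → length (beadGaps w) ≡ beads w
length-beadGaps []          = refl
length-beadGaps (true ∷ w)  = trans (length-++ (beadGaps w)) (trans (+-comm _ 1) (cong suc (length-beadGaps w)))
length-beadGaps (false ∷ w) = trans (length-map suc (beadGaps w)) (length-beadGaps w)

beadGaps-∷ʳ-bead : ∀ w → beadGaps (w ∷ʳ true) ≡ spacers w ∷ beadGaps w
beadGaps-∷ʳ-bead []          = refl
beadGaps-∷ʳ-bead (true ∷ w)  = cong (_∷ʳ 0) (beadGaps-∷ʳ-bead w)
beadGaps-∷ʳ-bead (false ∷ w) = cong (map suc) (beadGaps-∷ʳ-bead w)

beadGaps-∷ʳ-spacer : ∀ w → beadGaps (w ∷ʳ false) ≡ beadGaps w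
beadGaps-∷ʳ-spacer []          = refl
beadGaps-∷ʳ-spacer (true ∷ w)  = cong (_∷ʳ 0) (beadGaps-∷ʳ-spacer w)
beadGaps-∷ʳ-spacer (false ∷ w) = cong (map suc) (beadGaps-∷ʳ-spacer w)

positives-∷ʳ-0 : ∀ μ → positives (μ ∷ʳ 0) ≡ positives μ
positives-∷ʳ-0 μ = trans (filter-++ (0 <?_) μ [ 0 ]) (++-identityʳ (positives μ))

positives-map-suc : ∀ μ → positives (map suc μ) ≡ map suc μ
positives-map-suc μ = filter-all (0 <?_) (map⁺ (All.universal (λ _ → s≤s z≤n) μ))

wordPartition-∷-bead : ∀ w → wordPartition (true ∷ w) ≡ wordPartition w
wordPartition-∷-bead w = positives-∷ʳ-0 (beadGaps w)

wordPartition-∷-spacer : ∀ w → wordPartition (false ∷ w) ≡ map suc (beadGaps w)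
wordPartition-∷-spacer w = positives-map-suc (beadGaps w)

length-wordPartition≤beads : ∀ w → length (wordPartition w) ≤ beads w
length-wordPartition≤beads w = ≤-trans (length-filter (0 <?_) (beadGaps w)) (≤-reflexive (length-beadGaps w))

dual-applyUpTo : ∀ (f : ℕ → Bool) n → dual (applyUpTo f n) ≡ applyUpTo (λ j → not (f (n ∸ 1 ∸ j))) n
dual-applyUpTo f n = begin
  reverse (map not (applyUpTo f n))              ≡⟨ cong reverse (map-applyUpTo f not n) ⟩
  reverse (applyUpTo (not ∘ f) n)                ≡⟨ reverse-applyUpTo (not ∘ f) n ⟩
  applyDownFrom (not ∘ f) n                      ≡⟨ applyDownFrom≡applyUpTo (not ∘ f) n ⟩
  applyUpTo (λ j → not (f (n ∸ suc j))) n        ≡⟨ applyUpTo-cong n (λ j _ → cong (not ∘ f) (sym (∸-+-assoc n 1 j))) ⟩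
  applyUpTo (λ j → not (f (n ∸ 1 ∸ j))) n        ∎

wordPartition-∷-bead≢∷-spacer : ∀ v v′ → beads (true ∷ v) ≡ beads (false ∷ v′) →
                                wordPartition (true ∷ v) ≢ wordPartition (false ∷ v′)
wordPartition-∷-bead≢∷-spacer v v′ same-beads e =
  1+n≰n (≤-trans (≤-reflexive more-parts) (length-wordPartition≤beads v))
  where
  more-parts : suc (beads v) ≡ length (wordPartition v)
  more-parts = begin
    suc (beads v)                        ≡⟨ same-beads ⟩
    beads v′                             ≡⟨ sym (length-beadGaps v′) ⟩
    length (beadGaps v′)                 ≡⟨ sym (length-map suc (beadGaps v′)) ⟩
    length (map suc (beadGaps v′))       ≡⟨ cong length (sym (wordPartition-∷-spacer v′)) ⟩
    length (wordPartition (false ∷ v′))  ≡⟨ cong length (sym e) ⟩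
    length (wordPartition (true ∷ v))    ≡⟨ cong length (wordPartition-∷-bead v) ⟩
    length (wordPartition v)             ∎

wordPartition-injective : ∀ w w′ → length w ≡ length w′ → beads w ≡ beads w′ →
                          wordPartition w ≡ wordPartition w′ → w ≡ w′
wordPartition-injective []          []           _ _ _ = refl
wordPartition-injective (true ∷ v)  (true ∷ v′)  l b e =
  cong (true ∷_) (wordPartition-injective v v′ (suc-injective l) (suc-injective b)
    (trans (sym (wordPartition-∷-bead v)) (trans e (wordPartition-∷-bead v′))))
wordPartition-injective (false ∷ v) (false ∷ v′) l b e =
  cong (false ∷_) (wordPartition-injective v v′ (suc-injective l) b (cong positives same-gaps))
  where
  same-gaps : beadGaps v ≡ beadGaps v′
  same-gaps = map-injective suc-injective
    (trans (sym (wordPartition-∷-spacer v)) (trans e (wordPartition-∷-spacer v′)))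
wordPartition-injective (true ∷ v)  (false ∷ v′) l b e = ⊥-elim (wordPartition-∷-bead≢∷-spacer v v′ b e)
wordPartition-injective (false ∷ v) (true ∷ v′)  l b e = ⊥-elim (wordPartition-∷-bead≢∷-spacer v′ v (sym b) (sym e))

partsAbove : ℕ → List ℕ → ℕ
partsAbove k μ = length (filter (suc k ≤?_) μ)

conjugate-cong : ∀ {μ ν} → maxL μ ≡ maxL ν → (∀ k → partsAbove k μ ≡ partsAbove k ν) →
                 conjugate μ ≡ conjugate ν
conjugate-cong {μ} {ν} same-max same-parts =
  trans (cong (λ M → map (λ k → partsAbove k μ) (upTo M)) same-max) (map-cong same-parts (upTo (maxL ν)))

maxL-positives : ∀ μ → maxL (positives μ) ≡ maxL μ
maxL-positives []          = refl
maxL-positives (zero ∷ μ)  = maxL-positives μ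
maxL-positives (suc x ∷ μ) = cong (suc x ⊔_) (maxL-positives μ)

conjugate-positives : ∀ μ → conjugate (positives μ) ≡ conjugate μ
conjugate-positives μ = conjugate-cong {positives μ} {μ} (maxL-positives μ)
  (λ k → cong length (filter-filter-⊆ (suc k ≤?_) (0 <?_) (≤-trans (s≤s z≤n)) μ))

conjugate-∷ʳ-0 : ∀ μ → conjugate (μ ∷ʳ 0) ≡ conjugate μ
conjugate-∷ʳ-0 μ = begin
  conjugate (μ ∷ʳ 0)             ≡⟨ sym (conjugate-positives (μ ∷ʳ 0)) ⟩
  conjugate (positives (μ ∷ʳ 0)) ≡⟨ cong conjugate (positives-∷ʳ-0 μ) ⟩
  conjugate (positives μ)        ≡⟨ conjugate-positives μ ⟩
  conjugate μ                    ∎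

maxL-map-suc : ∀ x μ → maxL (map suc (x ∷ μ)) ≡ suc (maxL (x ∷ μ))
maxL-map-suc x []      = trans (⊔-identityʳ (suc x)) (cong suc (sym (⊔-identityʳ x)))
maxL-map-suc x (y ∷ μ) = cong (suc x ⊔_) (maxL-map-suc y μ)

partsAbove-map-suc : ∀ k μ → partsAbove (suc k) (map suc μ) ≡ partsAbove k μ
partsAbove-map-suc k []      = refl
partsAbove-map-suc k (x ∷ μ) with suc k ≤? x
... | yes k<x = trans (cong length (filter-accept (suc (suc k) ≤?_) (s≤s k<x)))
                      (trans (cong suc (partsAbove-map-suc k μ)) (sym (cong length (filter-accept (suc k ≤?_) k<x))))
... | no  k≮x = trans (cong length (filter-reject (suc (suc k) ≤?_) (k≮x ∘ s≤s⁻¹)))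
                      (trans (partsAbove-map-suc k μ) (sym (cong length (filter-reject (suc k ≤?_) k≮x))))

partsAbove-0-map-suc : ∀ μ → partsAbove 0 (map suc μ) ≡ length μ
partsAbove-0-map-suc []      = refl
partsAbove-0-map-suc (x ∷ μ) = cong suc (partsAbove-0-map-suc μ)

-- A new first column of height length μ becomes a new first row of the conjugate.
conjugate-map-suc : ∀ μ → conjugate (map suc μ) ≡ positives [ length μ ] ++ conjugate μ
conjugate-map-suc []      = refl
conjugate-map-suc (x ∷ μ) = begin
  map f (upTo (maxL (map suc (x ∷ μ))))     ≡⟨ cong (map f ∘ upTo) (maxL-map-suc x μ) ⟩
  f 0 ∷ map f (applyUpTo suc M)             ≡⟨ cong (λ l → f 0 ∷ map f l) (sym (map-upTo suc M)) ⟩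
  f 0 ∷ map f (map suc (upTo M))            ≡⟨ cong (f 0 ∷_) (sym (map-∘ (upTo M))) ⟩
  f 0 ∷ map (f ∘ suc) (upTo M)              ≡⟨ cong₂ _∷_ (partsAbove-0-map-suc (x ∷ μ))
                                                        (map-cong (λ k → partsAbove-map-suc k (x ∷ μ)) (upTo M)) ⟩
  length (x ∷ μ) ∷ conjugate (x ∷ μ)        ∎
  where
  f : ℕ → ℕ
  f k = partsAbove k (map suc (x ∷ μ))
  M : ℕ
  M = maxL (x ∷ μ)

conjugate-beadGaps : ∀ w → conjugate (beadGaps w) ≡ wordPartition (dual w)
conjugate-beadGaps []          = refl
conjugate-beadGaps (true ∷ w)  = begin
  conjugate (beadGaps w ∷ʳ 0)          ≡⟨ conjugate-∷ʳ-0 (beadGaps w) ⟩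
  conjugate (beadGaps w)               ≡⟨ conjugate-beadGaps w ⟩
  wordPartition (dual w)               ≡⟨ cong positives (sym (beadGaps-∷ʳ-spacer (dual w))) ⟩
  wordPartition (dual w ∷ʳ false)      ≡⟨ cong wordPartition (sym (dual-∷ true w)) ⟩
  wordPartition (dual (true ∷ w))      ∎
conjugate-beadGaps (false ∷ w) = begin
  conjugate (map suc (beadGaps w))                           ≡⟨ conjugate-map-suc (beadGaps w) ⟩
  positives [ length (beadGaps w) ] ++ conjugate (beadGaps w) ≡⟨ cong₂ (λ n μ → positives [ n ] ++ μ)
                                                                   (trans (length-beadGaps w) (sym (spacers-dual w)))
                                                                   (conjugate-beadGaps w) ⟩
  positives [ spacers (dual w) ] ++ wordPartition (dual w)    ≡⟨ sym (filter-++ (0 <?_) [ spacers (dual w) ] _) ⟩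
  positives (spacers (dual w) ∷ beadGaps (dual w))            ≡⟨ cong positives (sym (beadGaps-∷ʳ-bead (dual w))) ⟩
  wordPartition (dual w ∷ʳ true)                              ≡⟨ cong wordPartition (sym (dual-∷ false w)) ⟩
  wordPartition (dual (false ∷ w))                            ∎

conjugate-wordPartition : ∀ w → conjugate (wordPartition w) ≡ wordPartition (dual w)
conjugate-wordPartition w = trans (conjugate-positives (beadGaps w)) (conjugate-beadGaps w)

HorizontallyAntisymmetric : Pred ℕ 0ℓ → ℕ → Set
HorizontallyAntisymmetric P q = ∀ j → j < q → P j ⇔ (¬ P (q ∸ 1 ∸ j))

indicatorWord : ∀ {P : Pred ℕ 0ℓ} → Decidable P → ℕ → List Bool
indicatorWord P? n = applyUpTo (λ j → does (P? j)) n

antisymmetric⇔selfDual : ∀ {P : Pred ℕ 0ℓ} (P? : Decidable P) q →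
                         HorizontallyAntisymmetric P q ⇔ (indicatorWord P? q ≡ dual (indicatorWord P? q))
antisymmetric⇔selfDual {P} P? q = mk⇔
  (λ anti → trans (applyUpTo-cong q (λ j j<q → from (pointwise j) (anti j j<q)))
                  (sym (dual-applyUpTo (λ j → does (P? j)) q)))
  (λ selfDual j j<q → to (pointwise j)
     (applyUpTo-cong⁻ q (trans selfDual (dual-applyUpTo (λ j → does (P? j)) q)) j j<q))
  where
  pointwise : ∀ j → (does (P? j) ≡ not (does (P? (q ∸ 1 ∸ j)))) ⇔ (P j ⇔ (¬ P (q ∸ 1 ∸ j)))
  pointwise j = does≡not-does⇔ (P? j) (P? (q ∸ 1 ∸ j))

selfDual⇔selfConjugate×balanced : ∀ w {n} → length w ≡ n →
  (w ≡ dual w) ⇔ (SelfConjugate (wordPartition w) × beads w * 2 ≡ n)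
selfDual⇔selfConjugate×balanced w refl = mk⇔
  (λ selfDual → selfConjugate selfDual , balanced selfDual)
  (λ (sc , b) → wordPartition-injective w (dual w) (sym (length-dual w)) (balanced⇒beads-dual b)
                  (trans sc (conjugate-wordPartition w)))
  where
  balanced⇔ : (beads w * 2 ≡ beads w + spacers w) ⇔ (beads w ≡ spacers w)
  balanced⇔ = n*2≡n+m⇔n≡m (beads w) (spacers w)

  selfConjugate : w ≡ dual w → SelfConjugate (wordPartition w)
  selfConjugate selfDual = trans (cong wordPartition selfDual) (sym (conjugate-wordPartition w))

  balanced : w ≡ dual w → beads w * 2 ≡ length w
  balanced selfDual =
    trans (from balanced⇔ (trans (cong beads selfDual) (beads-dual w))) (beads+spacers≡length w)

  balanced⇒beads-dual : beads w * 2 ≡ length w → beads w ≡ beads (dual w)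
  balanced⇒beads-dual b =
    trans (to balanced⇔ (trans b (sym (beads+spacers≡length w)))) (sym (beads-dual w))

-- The partition of a bead-set read off its indicator word

module _ {P : Pred ℕ 0ℓ} (P? : Decidable P) where

  beads-map-does : ∀ xs → beads (map (λ j → does (P? j)) xs) ≡ length (filter P? xs)
  beads-map-does []       = refl
  beads-map-does (x ∷ xs) with P? x
  ... | yes _ = cong suc (beads-map-does xs)
  ... | no  _ = beads-map-does xs

  spacers-map-does : ∀ {Y} xs → (∀ {z} → z ∈ xs → z ∈ Y ⇔ P z) →
                     spacers (map (λ j → does (P? j)) xs) ≡ length (filter (λ z → ¬? (z ∈? Y)) xs)
  spacers-map-does         []       _    = refl
  spacers-map-does {Y} (x ∷ xs) ∈Y⇔P with P? x
  ... | yes p = trans (spacers-map-does xs (∈Y⇔P ∘ there))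
                      (sym (cong length (filter-reject (λ z → ¬? (z ∈? Y)) (λ x∉Y → x∉Y (from (∈Y⇔P (here refl)) p)))))
  ... | no ¬p = trans (cong suc (spacers-map-does xs (∈Y⇔P ∘ there)))
                      (sym (cong length (filter-accept (λ z → ¬? (z ∈? Y)) (¬p ∘ to (∈Y⇔P (here refl))))))

  length-filter-upTo : ∀ n → length (filter P? (upTo n)) ≡ beads (indicatorWord P? n)
  length-filter-upTo n = trans (sym (beads-map-does (upTo n))) (cong beads (map-upTo _ n))

  ∈-filter-upTo⇔ : ∀ {n z} → z < n → z ∈ filter P? (upTo n) ⇔ P z
  ∈-filter-upTo⇔ {n} z<n = mk⇔ (proj₂ ∘ ∈-filter⁻ P? {xs = upTo n}) (∈-filter⁺ P? (∈-upTo⁺ z<n))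

  gapsBelow-filter-upTo : ∀ {n y} → y ≤ n → gapsBelow (filter P? (upTo n)) y ≡ spacers (indicatorWord P? y)
  gapsBelow-filter-upTo {y = y} y≤n = sym (trans (cong spacers (sym (map-upTo _ y)))
    (spacers-map-does (upTo y) (λ z∈ → ∈-filter-upTo⇔ (<-≤-trans (∈-upTo⁻ z∈) y≤n))))

  beadGaps-filter-upTo : ∀ {n} k → k ≤ n →
    reverse (map (gapsBelow (filter P? (upTo n))) (filter P? (upTo k))) ≡ beadGaps (indicatorWord P? k)
  beadGaps-filter-upTo zero    _   = refl
  beadGaps-filter-upTo {n} (suc k) k<n = begin
    reverse (map G (filter P? (upTo (suc k))))                   ≡⟨ cong (reverse ∘ map G) (filter-upTo-suc P? k) ⟩
    reverse (map G (filter P? (upTo k) ++ filter P? [ k ]))      ≡⟨ cong reverse (map-++ G (filter P? (upTo k)) _) ⟩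
    reverse (map G (filter P? (upTo k)) ++ map G (filter P? [ k ])) ≡⟨ reverse-++ (map G (filter P? (upTo k))) _ ⟩
    reverse (map G (filter P? [ k ])) ++ reverse (map G (filter P? (upTo k)))
      ≡⟨ cong (reverse (map G (filter P? [ k ])) ++_) (beadGaps-filter-upTo k (<⇒≤ k<n)) ⟩
    reverse (map G (filter P? [ k ])) ++ beadGaps W             ≡⟨ newest (P? k) ⟩
    beadGaps (W ∷ʳ does (P? k))                                  ≡⟨ cong beadGaps (applyUpTo-∷ʳ _ k) ⟩
    beadGaps (indicatorWord P? (suc k))                          ∎
    where
    G : ℕ → ℕ
    G = gapsBelow (filter P? (upTo n))
    W : List Bool
    W = indicatorWord P? k
    newest : (d : Dec (P k)) → reverse (map G (filter P? [ k ])) ++ beadGaps W ≡ beadGaps (W ∷ʳ does d)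
    newest (yes p) = begin
      reverse (map G (filter P? [ k ])) ++ beadGaps W ≡⟨ cong (λ l → reverse (map G l) ++ beadGaps W) (filter-accept P? p) ⟩
      G k ∷ beadGaps W                                ≡⟨ cong (_∷ beadGaps W) (gapsBelow-filter-upTo (<⇒≤ k<n)) ⟩
      spacers W ∷ beadGaps W                          ≡⟨ sym (beadGaps-∷ʳ-bead W) ⟩
      beadGaps (W ∷ʳ true)                            ∎
    newest (no ¬p) = trans (cong (λ l → reverse (map G l) ++ beadGaps W) (filter-reject P? ¬p))
                           (sym (beadGaps-∷ʳ-spacer W))

  partitionOf-filter-upTo : ∀ n → partitionOf (filter P? (upTo n)) ≡ wordPartition (indicatorWord P? n)
  partitionOf-filter-upTo n =
    trans (sym (filter-reverse (0 <?_) (map (gapsBelow (filter P? (upTo n))) (filter P? (upTo n)))))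
          (cong positives (beadGaps-filter-upTo n ≤-refl))

  filter-upTo-stable : ∀ {q N} → (∀ j → q ≤ j → ¬ P j) → q ≤′ N → filter P? (upTo N) ≡ filter P? (upTo q)
  filter-upTo-stable absent ≤′-refl                    = refl
  filter-upTo-stable {q} absent (≤′-step {N} q≤′N) = begin
    filter P? (upTo (suc N))                ≡⟨ filter-upTo-suc P? N ⟩
    filter P? (upTo N) ++ filter P? [ N ]   ≡⟨ cong (filter P? (upTo N) ++_) (filter-reject P? (absent N (≤′⇒≤ q≤′N))) ⟩
    filter P? (upTo N) ++ []                ≡⟨ ++-identityʳ (filter P? (upTo N)) ⟩
    filter P? (upTo N)                      ≡⟨ filter-upTo-stable absent q≤′N ⟩
    filter P? (upTo q)                      ∎

-- Runners of the s-abacus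

runner? : ∀ s i X → Decidable (λ j → i + j * s ∈ X)
runner? s i X j = i + j * s ∈? X

rows≤suc-maxL : ∀ s .{{_ : NonZero s}} {q} X → Any (λ x → suc (x / s) ≡ q) X → q ≤ suc (maxL X)
rows≤suc-maxL s X top with x , x∈X , refl ← find top = s≤s (≤-trans (m/n≤m x s) (∈⇒≤maxL X x∈X))

∉-beyond-rows : ∀ s .{{_ : NonZero s}} {q} X → All (λ x → x / s < q) X → ∀ i j → q ≤ j → i + j * s ∉ X
∉-beyond-rows s X rows i j q≤j x∈X = <⇒≱ (All.lookup rows x∈X) (≤-trans q≤j j≤row)
  where
  j≤row : j ≤ (i + j * s) / s
  j≤row = ≤-trans (≤-reflexive (sym (m*n/n≡m j s))) (/-monoˡ-≤ s (m≤n+m (j * s) i))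

runner-antisymmetric⇔ : ∀ s .{{_ : NonZero s}} X q → All (λ x → x / s < q) X → q ≤ suc (maxL X) → ∀ i →
  HorizontallyAntisymmetric (λ j → i + j * s ∈ X) q ⇔
  (SelfConjugate (quotientComponent s i X) × length (runnerSet s i X) * 2 ≡ q)
runner-antisymmetric⇔ s X q rows q≤1+max i =
  subst₂ (λ μ b → HorizontallyAntisymmetric (λ j → i + j * s ∈ X) q ⇔ (SelfConjugate μ × b * 2 ≡ q))
    (sym (trans (cong partitionOf runner-rows) (partitionOf-filter-upTo (runner? s i X) q)))
    (sym (trans (cong length runner-rows) (length-filter-upTo (runner? s i X) q)))
    (selfDual⇔selfConjugate×balanced (indicatorWord (runner? s i X) q) (length-applyUpTo _ q)
      ⇔-∘ antisymmetric⇔selfDual (runner? s i X) q)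
  where
  runner-rows : runnerSet s i X ≡ filter (runner? s i X) (upTo q)
  runner-rows = filter-upTo-stable (runner? s i X) (∉-beyond-rows s X rows i) (≤⇒≤′ q≤1+max)

lemma4p4 : (s : ℕ) .{{_ : NonZero s}} (λ′ : List ℕ) → IsPartition λ′ →
    (m : ℕ) → (m + length λ′) % s ≡ 0 →
    (∀ m′ → m′ < m → (m′ + length λ′) % s ≢ 0) →
    (q : ℕ) → Any (λ x → suc (x / s) ≡ q) (beadSet m λ′) →
    All (λ x → x / s < q) (beadSet m λ′) →
    ((∀ i → i < s → ∀ j → j < q →
        (i + j * s ∈ beadSet m λ′) ⇔ (i + (q ∸ 1 ∸ j) * s ∉ beadSet m λ′))
     ⇔
     ((2 ∣ q) ×
      (∀ i → i < s → SelfConjugate (quotientComponent s i (beadSet m λ′))) ×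
      (∀ i → i < s → length (runnerSet s i (beadSet m λ′)) ≡ q / 2)))
lemma4p4 s λ′ _ m _ _ q top rows = mk⇔
  (λ anti → let balanced i i<s = to (runner i) (anti i i<s) in
    divides (length (runnerSet s 0 X)) (sym (proj₂ (balanced 0 (>-nonZero⁻¹ s)))) ,
    (λ i i<s → proj₁ (balanced i i<s)) ,
    (λ i i<s → trans (sym (m*n/n≡m _ 2)) (/-congˡ (proj₂ (balanced i i<s)))))
  (λ (2∣q , selfConjugate , half) i i<s →
    from (runner i) (selfConjugate i i<s , trans (cong (_* 2) (half i i<s)) (m/n*n≡m 2∣q)))
  where
  X : List ℕ
  X = beadSet m λ′
  runner : ∀ i → HorizontallyAntisymmetric (λ j → i + j * s ∈ X) q ⇔
                 (SelfConjugate (quotientComponent s i X) × length (runnerSet s i X) * 2 ≡ q)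
  runner = runner-antisymmetric⇔ s X q rows (rows≤suc-maxL s X top)
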